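{- For every odd integer $a\ge5$, the subtraction game $\mathcal{S}(a,2a+1,3a)$ is ultimately bipartite; that is, there exists $n_0\ge0$ such that for all $n\ge n_0$, $\mathcal{G}(n)=0$ if $n-n_0$ is even and $\mathcal{G}(n)=1$ if $n-n_0$ is odd.
   Context: For a finite set $S$ of positive integers, the subtraction game $\mathcal{S}(S)$ is played on a single pile of coins: two players alternately remove $s\in S$ coins (with $s$ at most the pile size); the player making the last move wins. The nim-value (Sprague–Grundy value) of a pile of $n$ coins is $\mathcal{G}(n)=\operatorname{mex}\{\mathcal{G}(n-s): s\in S,\ s\le n\}$. A subtraction game is ultimately bipartite if its nim-sequence is ultimately periodic with period 2, eventually taking the alternating values $0,1,0,1,\ldots$. -}

module Defs where

open import Data.Nat using (ℕ; zero; suc; _≤ᵇ_; _≡ᵇ_; _+_; _*_)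
open import Data.Product using (Σ; _×_)
open import Relation.Binary.PropositionalEquality using (_≡_)
open import Data.Bool using (Bool; true; false; if_then_else_)
open import Data.List using (List; []; _∷_; length)

elemᵇ : ℕ → List ℕ → Bool
elemᵇ k [] = false
elemᵇ k (x ∷ xs) = if k ≡ᵇ x then true else elemᵇ k xs

-- mex: least natural number not in the list.  It is among 0 .. length xs,
-- so a search with fuel (length xs + 1) starting at 0 finds it.
mexSearch : ℕ → ℕ → List ℕ → ℕ
mexSearch zero k xs = k
mexSearch (suc fuel) k xs = if elemᵇ k xs then mexSearch fuel (suc k) xs else k

mex : List ℕ → ℕ
mex xs = mexSearch (suc (length xs)) 0 xs

-- Element at position i of a list (0 if out of range; never used out of range).
nth : List ℕ → ℕ → ℕ
nth [] i = 0
nth (x ∷ xs) zero = x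
nth (x ∷ xs) (suc i) = nth xs i

-- history S n = [G(n-1), G(n-2), ..., G(0)], so G(n - s) is at index s - 1.
-- options S hist: nim-values of positions reachable by removing s ∈ S
-- coins, 1 ≤ s ≤ pile size (= length hist).
options : List ℕ → List ℕ → List ℕ
options [] hist = []
options (zero ∷ S) hist = options S hist
options (suc s ∷ S) hist =
  if suc s ≤ᵇ length hist then nth hist s ∷ options S hist else options S hist

history : List ℕ → ℕ → List ℕ
history S zero = []
history S (suc n) = mex (options S (history S n)) ∷ history S n

grundy : List ℕ → ℕ → ℕ
grundy S n = mex (options S (history S n))

UltimatelyBipartite : List ℕ → Set
UltimatelyBipartite S =
  Σ ℕ λ n₀ → (k : ℕ) → (grundy S (n₀ + 2 * k) ≡ 0) × (grundy S (n₀ + 2 * k + 1) ≡ 1)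

module Submission where

-- Write a position as n = q·a + r with column r < a, and group the rows q in
-- blocks of four, q = 4j + i.  The nim-value of n depends only on i and the
-- offset δ = r − 2j: it is shapeᵢ δ, four explicit functions on ℤ that follow
-- the parity of q + r for δ ≤ −2 and carry a few defects near δ = 0.  The file
--   1. restates grundy without its history list (reachable, grundy-unfold) and
--      proves parity propagation: if all moves are odd and the nim-sequence
--      alternates on a window as long as the largest move, it alternates forever;
--   2. defines the shapes and checks the local mex rules they satisfy
--      (shape-rule, board-rule, ColumnZero), a finite case analysis on δ;
--   3. in ThreeMoveGame, proves by induction on blocks that every row follows its
--      shape (next-row, blocks).  In block b + 1 all columns lie at δ ≤ −2, so
--      three whole rows alternate, and parity propagation finishes the proof.

open import Defs
open import Data.Bool using (true; false; if_then_else_)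
open import Data.Integer using (ℤ; +_; -[1+_]; pred; _⊖_)
import Data.Integer.Properties as ℤ
open import Data.List using (List; []; _∷_; length; map)
open import Data.List.Relation.Unary.All using (All; []; _∷_)
open import Data.List.Relation.Unary.All.Properties using (map⁺)
open import Data.Nat using (ℕ; zero; suc; _+_; _*_; _∸_; _≤_; _<_; z≤n; s≤s; _≤ᵇ_; _≡ᵇ_; _<?_)
open import Data.Nat.Induction using (<-rec)
open import Data.Nat.Properties
open import Data.Nat.Tactic.RingSolver using (solve-∀)
open import Data.Product using (Σ; _×_; _,_; proj₁; proj₂)
open import Data.Sum using (_⊎_; inj₁; inj₂)
open import Relation.Binary.PropositionalEquality
open import Relation.Nullary using (yes; no; contradiction)
open import Relation.Nullary.Reflects using (ofʸ; ofⁿ)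

reachable : List ℕ → List ℕ → ℕ → List ℕ
reachable S [] n = []
reachable S (zero ∷ T) n = reachable S T n
reachable S (suc s ∷ T) n =
  if suc s ≤ᵇ n then grundy S (n ∸ suc s) ∷ reachable S T n else reachable S T n

length-history : ∀ S n → length (history S n) ≡ n
length-history S zero = refl
length-history S (suc n) = cong suc (length-history S n)

nth-history : ∀ S n i → i < n → nth (history S n) i ≡ grundy S (n ∸ suc i)
nth-history S (suc n) zero _ = refl
nth-history S (suc n) (suc i) (s≤s i<n) = nth-history S n i i<n

options-history : ∀ S T n → options T (history S n) ≡ reachable S T n
options-history S [] n = refl
options-history S (zero ∷ T) n = options-history S T n
options-history S (suc s ∷ T) n rewrite length-history S n
  with suc s ≤ᵇ n | ≤ᵇ-reflects-≤ (suc s) n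
... | true | ofʸ s<n = cong₂ _∷_ (nth-history S n s s<n) (options-history S T n)
... | false | ofⁿ _ = options-history S T n

grundy-unfold : ∀ S n → grundy S n ≡ mex (reachable S S n)
grundy-unfold S n = cong mex (options-history S S n)

reachable-legal : ∀ S T {s} n → suc s ≤ n →
  reachable S (suc s ∷ T) n ≡ grundy S (n ∸ suc s) ∷ reachable S T n
reachable-legal S T {s} n s≤n with suc s ≤ᵇ n | ≤ᵇ-reflects-≤ (suc s) n
... | true | _ = refl
... | false | ofⁿ s≰n = contradiction s≤n s≰n

reachable-illegal : ∀ S T {s} n → n < suc s → reachable S (suc s ∷ T) n ≡ reachable S T n
reachable-illegal S T {s} n n<s with suc s ≤ᵇ n | ≤ᵇ-reflects-≤ (suc s) n
... | true | ofʸ s≤n = contradiction s≤n (<⇒≱ n<s)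
... | false | _ = refl

reachable-all : ∀ S T n → All (λ s → 0 < s × s ≤ n) T →
  reachable S T n ≡ map (λ s → grundy S (n ∸ s)) T
reachable-all S [] n [] = refl
reachable-all S (suc s ∷ T) n ((_ , s≤n) ∷ legal) =
  trans (reachable-legal S T n s≤n) (cong (grundy S (n ∸ suc s) ∷_) (reachable-all S T n legal))

par : ℕ → ℕ
par zero = 0
par (suc zero) = 1
par (suc (suc n)) = par n

par-cases : ∀ n → (par n ≡ 0 × par (suc n) ≡ 1) ⊎ (par n ≡ 1 × par (suc n) ≡ 0)
par-cases zero = inj₁ (refl , refl)
par-cases (suc zero) = inj₂ (refl , refl)
par-cases (suc (suc n)) = par-cases n

par-even-suc : ∀ {n} → par n ≡ 0 → par (suc n) ≡ 1
par-even-suc {n} p with par-cases n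
... | inj₁ (_ , q) = q
... | inj₂ (p′ , _) with () ← trans (sym p′) p

par-suc-even : ∀ {n} → par (suc n) ≡ 0 → par n ≡ 1
par-suc-even {n} p with par-cases n
... | inj₁ (_ , q) with () ← trans (sym q) p
... | inj₂ (p′ , _) = p′

par-suc-cong : ∀ {m n} → par m ≡ par n → par (suc m) ≡ par (suc n)
par-suc-cong {m} {n} p with par-cases m | par-cases n
... | inj₁ (_ , q) | inj₁ (_ , q′) = trans q (sym q′)
... | inj₂ (_ , q) | inj₂ (_ , q′) = trans q (sym q′)
... | inj₁ (p₀ , _) | inj₂ (p₁ , _) with () ← trans (sym p₀) (trans p p₁)
... | inj₂ (p₁ , _) | inj₁ (p₀ , _) with () ← trans (sym p₀) (trans (sym p) p₁)

par-double+ : ∀ k n → par (k * 2 + n) ≡ par n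
par-double+ zero n = refl
par-double+ (suc k) n = par-double+ k n

par-double : ∀ k → par (k * 2) ≡ 0
par-double k = trans (cong par (sym (+-identityʳ (k * 2)))) (par-double+ k 0)

par-quadruple+ : ∀ k n → par (k * 4 + n) ≡ par n
par-quadruple+ zero n = refl
par-quadruple+ (suc k) n = par-quadruple+ k n

par-∸-odd : ∀ {s n} → par s ≡ 1 → s ≤ n → par (n ∸ s) ≡ par (suc n)
par-∸-odd {zero} () _
par-∸-odd {suc zero} {suc n} _ _ = refl
par-∸-odd {suc (suc s)} odd (s≤s (s≤s s≤n)) = par-∸-odd {s} odd s≤n

elemᵇ-const : ∀ {k v xs} → (k ≡ᵇ v) ≡ false → All (_≡ v) xs → elemᵇ k xs ≡ false
elemᵇ-const k≢v [] = refl
elemᵇ-const k≢v (refl ∷ ps) rewrite k≢v = elemᵇ-const k≢v ps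

mex-bit : ∀ {k x xs} → All (_≡ par k) (x ∷ xs) → mex (x ∷ xs) ≡ par (suc k)
mex-bit {k} ps with par-cases k
... | inj₁ (p , q) rewrite p | q = mex-zeros ps
  where
  mex-zeros : ∀ {x xs} → All (_≡ 0) (x ∷ xs) → mex (x ∷ xs) ≡ 1
  mex-zeros (refl ∷ ps) rewrite elemᵇ-const {1} refl ps = refl
... | inj₂ (p , q) rewrite p | q = mex-ones ps
  where
  mex-ones : ∀ {x xs} → All (_≡ 1) (x ∷ xs) → mex (x ∷ xs) ≡ 0
  mex-ones (refl ∷ ps) rewrite elemᵇ-const {0} refl ps = refl

mex₃-cong : ∀ {x x′ y y′ z z′} → x ≡ x′ → y ≡ y′ → z ≡ z′ →
  mex (x ∷ y ∷ z ∷ []) ≡ mex (x′ ∷ y′ ∷ z′ ∷ [])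
mex₃-cong refl refl refl = refl

-- Parity propagation: in a subtraction game all of whose moves are odd, once the
-- nim-sequence alternates on a window [m, m + M) with M at least every move, it
-- alternates forever.  Beyond the window every option of m + t has the parity of
-- m + t + 1 (by strong induction on t), and the mex of such equal bits is par (m + t).
parity-propagates : ∀ {s S′} m M → All (λ x → par x ≡ 1) (s ∷ S′) → All (_≤ M) (s ∷ S′) →
  (∀ t → t < M → grundy (s ∷ S′) (m + t) ≡ par (m + t)) →
  ∀ t → grundy (s ∷ S′) (m + t) ≡ par (m + t)
parity-propagates {s} {S′} m M odd bounded window = <-rec _ step
  where
  S : List ℕ
  S = s ∷ S′
  step : ∀ t → (∀ {u} → u < t → grundy S (m + u) ≡ par (m + u)) → grundy S (m + t) ≡ par (m + t)
  step t ih with t <? M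
  ... | yes t<M = window t t<M
  ... | no t≮M = begin
      grundy S n                           ≡⟨ grundy-unfold S n ⟩
      mex (reachable S S n)                ≡⟨ cong mex (reachable-all S S n (legal odd bounded)) ⟩
      mex (map (λ x → grundy S (n ∸ x)) S) ≡⟨ mex-bit {suc n} (map⁺ (flipped odd bounded)) ⟩
      par n                                ∎
    where
    open ≡-Reasoning
    n : ℕ
    n = m + t
    move≤t : ∀ {x} → x ≤ M → x ≤ t
    move≤t x≤M = ≤-trans x≤M (≮⇒≥ t≮M)
    -- every move is legal at n: odd, hence positive, and at most M ≤ t ≤ n
    legal : ∀ {T} → All (λ x → par x ≡ 1) T → All (_≤ M) T → All (λ x → 0 < x × x ≤ n) T
    legal [] [] = []
    legal {zero ∷ T} (() ∷ _) _
    legal {suc x ∷ T} (_ ∷ odd) (x≤M ∷ bounded) =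
      (s≤s z≤n , ≤-trans (move≤t x≤M) (m≤n+m t m)) ∷ legal odd bounded
    -- and leads to a position m + (t − x) with t − x < t, of parity opposite to n
    flipped : ∀ {T} → All (λ x → par x ≡ 1) T → All (_≤ M) T →
      All (λ x → grundy S (n ∸ x) ≡ par (suc n)) T
    flipped [] [] = []
    flipped {zero ∷ T} (() ∷ _) _
    flipped {suc x ∷ T} (x-odd ∷ odd) (x≤M ∷ bounded) = value ∷ flipped odd bounded
      where
      n∸x≡m+[t∸x] : n ∸ suc x ≡ m + (t ∸ suc x)
      n∸x≡m+[t∸x] = +-∸-assoc m (move≤t x≤M)
      value : grundy S (n ∸ suc x) ≡ par (suc n)
      value = begin
        grundy S (n ∸ suc x)       ≡⟨ cong (grundy S) n∸x≡m+[t∸x] ⟩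
        grundy S (m + (t ∸ suc x)) ≡⟨ ih (∸-monoʳ-< (s≤s z≤n) (move≤t x≤M)) ⟩
        par (m + (t ∸ suc x))      ≡⟨ cong par (sym n∸x≡m+[t∸x]) ⟩
        par (n ∸ suc x)            ≡⟨ par-∸-odd x-odd (≤-trans (move≤t x≤M) (m≤n+m t m)) ⟩
        par (suc n)                ∎

-- For the game with moves a, 2a + 1, 3a the nim-value of
-- q·a + r (0 ≤ r < a) with q = 4j + i depends only on i and the offset δ = r − 2j:
-- it is shapeᵢ δ.  For δ ≤ −2 all four shapes follow the parity of q + r; the
-- defects near δ = 0 move one column to the right per block and eventually leave
-- the board.

shape₀ shape₁ shape₂ shape₃ : ℤ → ℕ
shape₀ (+ _) = 0
shape₀ -[1+ 0 ] = 2
shape₀ -[1+ suc k ] = par k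
shape₁ (+ _) = 1
shape₁ -[1+ k ] = par k
shape₂ (+ 0) = 0
shape₂ (+ suc _) = 2
shape₂ -[1+ k ] = par (suc k)
shape₃ (+ 0) = 1
shape₃ (+ suc _) = 3
shape₃ -[1+ k ] = par k

mex-alternate : ∀ k → par (suc k) ≡ mex (par k ∷ par k ∷ par k ∷ [])
mex-alternate k = sym (mex-bit {k} (refl ∷ refl ∷ refl ∷ []))

-- Writing δ for the offset of column s + 1 in the block of the
-- three rows below, the three options of the new entry sit at offsets δ, δ − 1 and
-- δ (new row 3), resp. shifted by −2 for rows entering the next block.
shape-rule₃ : ∀ δ → shape₃ δ ≡ mex (shape₂ δ ∷ shape₁ (pred δ) ∷ shape₀ δ ∷ [])
shape-rule₃ (+ 0) = refl
shape-rule₃ (+ suc _) = refl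
shape-rule₃ -[1+ 0 ] = refl
shape-rule₃ -[1+ suc k ] = mex-alternate k

shape-rule₀ : ∀ δ → shape₀ (pred (pred δ)) ≡ mex (shape₃ δ ∷ shape₂ (pred δ) ∷ shape₁ δ ∷ [])
shape-rule₀ (+ 0) = refl
shape-rule₀ (+ 1) = refl
shape-rule₀ (+ suc (suc _)) = refl
shape-rule₀ -[1+ k ] = mex-alternate k

shape-rule₁ : ∀ δ →
  shape₁ (pred (pred δ)) ≡ mex (shape₀ (pred (pred δ)) ∷ shape₃ (pred δ) ∷ shape₂ δ ∷ [])
shape-rule₁ (+ 0) = refl
shape-rule₁ (+ 1) = refl
shape-rule₁ (+ suc (suc _)) = refl
shape-rule₁ -[1+ k ] = mex-alternate (suc k)

shape-rule₂ : ∀ δ → shape₂ (pred (pred δ)) ≡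
  mex (shape₁ (pred (pred δ)) ∷ shape₀ (pred (pred (pred δ))) ∷ shape₃ δ ∷ [])
shape-rule₂ (+ 0) = refl
shape-rule₂ (+ 1) = refl
shape-rule₂ (+ 2) = refl
shape-rule₂ (+ suc (suc (suc _))) = refl
shape-rule₂ -[1+ k ] = mex-alternate k

⊖-suc : ∀ m n → m ⊖ suc n ≡ pred (m ⊖ n)
⊖-suc m n = sym (ℤ.distribʳ-⊖-+-neg 0 m n)

⊖-pred : ∀ m n → m ⊖ n ≡ pred (suc m ⊖ n)
⊖-pred m n = trans (sym (ℤ.[1+m]⊖[1+n]≡m⊖n m n)) (⊖-suc (suc m) n)

parℤ : ℤ → ℕ
parℤ (+ n) = par n
parℤ -[1+ n ] = par (suc n)

parℤ-⊖ : ∀ m n → parℤ (m ⊖ n) ≡ par (m + n)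
parℤ-⊖ zero zero = refl
parℤ-⊖ zero (suc n) = refl
parℤ-⊖ (suc m) zero = cong par (sym (+-identityʳ (suc m)))
parℤ-⊖ (suc m) (suc n) = begin
  parℤ (suc m ⊖ suc n) ≡⟨ cong parℤ (ℤ.[1+m]⊖[1+n]≡m⊖n m n) ⟩
  parℤ (m ⊖ n)         ≡⟨ parℤ-⊖ m n ⟩
  par (m + n)          ≡⟨ cong par (sym (+-suc (suc m) n)) ⟩
  par (suc m + suc n)  ∎
  where open ≡-Reasoning

-- Values at even offsets (columns 0 and c = a − 1 are at even offsets in every block).
shape₀-even : ∀ δ → parℤ δ ≡ 0 → shape₀ δ ≡ 0
shape₀-even (+ _) _ = refl
shape₀-even -[1+ suc k ] p = p

shape₁-even : ∀ δ → parℤ δ ≡ 0 → shape₁ δ ≡ 1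
shape₁-even (+ _) _ = refl
shape₁-even -[1+ k ] p = par-suc-even {k} p

shape₂-even : ∀ δ → parℤ δ ≡ 0 → shape₂ δ ≡ 0 ⊎ shape₂ δ ≡ 2
shape₂-even (+ 0) _ = inj₁ refl
shape₂-even (+ suc _) _ = inj₂ refl
shape₂-even -[1+ k ] p = inj₁ p

shape₃-even : ∀ δ → parℤ δ ≡ 0 → shape₃ δ ≡ 1 ⊎ shape₃ δ ≡ 3
shape₃-even (+ 0) _ = inj₁ refl
shape₃-even (+ suc _) _ = inj₂ refl
shape₃-even -[1+ k ] p = inj₁ (par-suc-even {k} p)

shape₂-col₀ : ∀ d → par d ≡ 0 → shape₂ (0 ⊖ d) ≡ 0
shape₂-col₀ zero _ = refl
shape₂-col₀ (suc d) p = p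

shape₃-col₀ : ∀ d → par d ≡ 0 → shape₃ (0 ⊖ d) ≡ 1
shape₃-col₀ zero _ = refl
shape₃-col₀ (suc d) p = par-suc-even {d} p

mex-col₀-even : ∀ {x} → x ≡ 0 ⊎ x ≡ 2 → 1 ≡ mex (0 ∷ x ∷ 0 ∷ [])
mex-col₀-even (inj₁ refl) = refl
mex-col₀-even (inj₂ refl) = refl

mex-col₀-odd : ∀ {x} → x ≡ 1 ⊎ x ≡ 3 → 0 ≡ mex (1 ∷ x ∷ 1 ∷ [])
mex-col₀-odd (inj₁ refl) = refl
mex-col₀-odd (inj₂ refl) = refl

offset-deep : ∀ r d → suc r < d → Σ ℕ λ k → r ⊖ d ≡ -[1+ suc k ]
offset-deep zero (suc zero) (s≤s ())
offset-deep zero (suc (suc k)) _ = k , refl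
offset-deep (suc r) (suc d) (s≤s r<d) with offset-deep r d r<d
... | k , eq = k , trans (ℤ.[1+m]⊖[1+n]≡m⊖n r d) eq

-- The rules in board coordinates for column s + 1, whose options lie in columns
-- s + 1, s and s + 1 of the three rows below; the block offset is d, and 2 + d for
-- rows that begin the next block.
board-rule₃ : ∀ d s → shape₃ (suc s ⊖ d) ≡
  mex (shape₂ (suc s ⊖ d) ∷ shape₁ (s ⊖ d) ∷ shape₀ (suc s ⊖ d) ∷ [])
board-rule₃ d s rewrite ⊖-pred s d = shape-rule₃ (suc s ⊖ d)

board-rule₀ : ∀ d s → shape₀ (suc s ⊖ suc (suc d)) ≡
  mex (shape₃ (suc s ⊖ d) ∷ shape₂ (s ⊖ d) ∷ shape₁ (suc s ⊖ d) ∷ [])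
board-rule₀ d s rewrite ⊖-suc (suc s) (suc d) | ⊖-suc (suc s) d | ⊖-pred s d = shape-rule₀ (suc s ⊖ d)

board-rule₁ : ∀ d s → shape₁ (suc s ⊖ suc (suc d)) ≡
  mex (shape₀ (suc s ⊖ suc (suc d)) ∷ shape₃ (s ⊖ d) ∷ shape₂ (suc s ⊖ d) ∷ [])
board-rule₁ d s rewrite ⊖-suc (suc s) (suc d) | ⊖-suc (suc s) d | ⊖-pred s d = shape-rule₁ (suc s ⊖ d)

board-rule₂ : ∀ d s → shape₂ (suc s ⊖ suc (suc d)) ≡
  mex (shape₁ (suc s ⊖ suc (suc d)) ∷ shape₀ (s ⊖ suc (suc d)) ∷ shape₃ (suc s ⊖ d) ∷ [])
board-rule₂ d s rewrite ⊖-suc (suc s) (suc d) | ⊖-suc (suc s) d | ⊖-suc s (suc d) | ⊖-suc s d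
                      | ⊖-pred s d = shape-rule₂ (suc s ⊖ d)

-- The rules in column 0: the options lie in column 0 of the rows below, except the
-- 2a + 1 option, which lies in the last column c of row q.  Both c and the block
-- offset d are even, so each value there is fixed up to the choice 0/2 or 1/3,
-- which does not affect the mex.
module ColumnZero {c d : ℕ} (d-even : par d ≡ 0) (cd-even : parℤ (c ⊖ d) ≡ 0) where

  d₀-even : parℤ (0 ⊖ d) ≡ 0
  d₀-even = trans (parℤ-⊖ 0 d) d-even

  board-rule₃-zero : shape₃ (0 ⊖ d) ≡ mex (shape₂ (0 ⊖ d) ∷ shape₀ (c ⊖ d) ∷ shape₀ (0 ⊖ d) ∷ [])
  board-rule₃-zero = trans (shape₃-col₀ d d-even)
    (sym (mex₃-cong (shape₂-col₀ d d-even) (shape₀-even (c ⊖ d) cd-even) (shape₀-even (0 ⊖ d) d₀-even)))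

  board-rule₀-zero : shape₀ (0 ⊖ suc (suc d)) ≡
    mex (shape₃ (0 ⊖ d) ∷ shape₁ (c ⊖ d) ∷ shape₁ (0 ⊖ d) ∷ [])
  board-rule₀-zero = trans d-even
    (sym (mex₃-cong (shape₃-col₀ d d-even) (shape₁-even (c ⊖ d) cd-even) (shape₁-even (0 ⊖ d) d₀-even)))

  board-rule₁-zero : shape₁ (0 ⊖ suc (suc d)) ≡
    mex (shape₀ (0 ⊖ suc (suc d)) ∷ shape₂ (c ⊖ d) ∷ shape₂ (0 ⊖ d) ∷ [])
  board-rule₁-zero = trans (par-even-suc {d} d-even) (trans (mex-col₀-even (shape₂-even (c ⊖ d) cd-even))
    (sym (mex₃-cong d-even (refl {x = shape₂ (c ⊖ d)}) (shape₂-col₀ d d-even))))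

  board-rule₂-zero : shape₂ (0 ⊖ suc (suc d)) ≡
    mex (shape₁ (0 ⊖ suc (suc d)) ∷ shape₃ (c ⊖ d) ∷ shape₃ (0 ⊖ d) ∷ [])
  board-rule₂-zero = trans d-even (trans (mex-col₀-odd (shape₃-even (c ⊖ d) cd-even))
    (sym (mex₃-cong (par-even-suc {d} d-even) (refl {x = shape₃ (c ⊖ d)}) (shape₃-col₀ d d-even))))

∸-from : ∀ {n m k} → n ≡ m + k → n ∸ k ≡ m
∸-from {m = m} {k} refl = m+n∸n≡m m k

≤-from : ∀ {n m k} → n ≡ m + k → k ≤ n
≤-from {m = m} {k} refl = m≤n+m k m

module ThreeMoveGame (b : ℕ) where

  c : ℕ
  c = b * 2

  a : ℕ
  a = suc c

  moves : List ℕ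
  moves = a ∷ 2 * a + 1 ∷ 3 * a ∷ []

  G : ℕ → ℕ
  G = grundy moves

  pos : ℕ → ℕ → ℕ
  pos q r = q * a + r

  -- The three moves in row coordinates: a goes one row up, 2a + 1 two rows up and
  -- one column left (wrapping from column 0 to column c = a − 1), 3a three rows up.
  pos-a : ∀ q r → pos (suc q) r ≡ pos q r + a
  pos-a q r = shuffle a (q * a) r
    where
    shuffle : ∀ y x r → (y + x) + r ≡ (x + r) + y
    shuffle = solve-∀

  pos-2a+1 : ∀ q s → pos (2 + q) (suc s) ≡ pos q s + (2 * a + 1)
  pos-2a+1 q s = shuffle a (q * a) s
    where
    shuffle : ∀ y x s → (y + (y + x)) + suc s ≡ (x + s) + (2 * y + 1)
    shuffle = solve-∀

  pos-2a+1-wrap : ∀ q → pos (3 + q) 0 ≡ pos q c + (2 * a + 1)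
  pos-2a+1-wrap q = shuffle c (q * a)
    where
    shuffle : ∀ y x → (suc y + (suc y + (suc y + x))) + 0 ≡ (x + y) + (2 * suc y + 1)
    shuffle = solve-∀

  pos-3a : ∀ q r → pos (3 + q) r ≡ pos q r + 3 * a
  pos-3a q r = shuffle a (q * a) r
    where
    shuffle : ∀ y x r → (y + (y + (y + x))) + r ≡ (x + r) + 3 * y
    shuffle = solve-∀

  legal-a : ∀ q r → a ≤ pos (suc q) r
  legal-a q r = ≤-from (pos-a q r)

  legal-2a+1 : ∀ q s → 2 * a + 1 ≤ pos (2 + q) (suc s)
  legal-2a+1 q s = ≤-from (pos-2a+1 q s)

  legal-3a : ∀ q r → 3 * a ≤ pos (3 + q) r
  legal-3a q r = ≤-from (pos-3a q r)

  minus-a : ∀ q r → pos (suc q) r ∸ a ≡ pos q r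
  minus-a q r = ∸-from (pos-a q r)

  minus-2a+1 : ∀ q s → pos (2 + q) (suc s) ∸ (2 * a + 1) ≡ pos q s
  minus-2a+1 q s = ∸-from (pos-2a+1 q s)

  minus-2a+1-wrap : ∀ q → pos (3 + q) 0 ∸ (2 * a + 1) ≡ pos q c
  minus-2a+1-wrap q = ∸-from (pos-2a+1-wrap q)

  minus-3a : ∀ q r → pos (3 + q) r ∸ 3 * a ≡ pos q r
  minus-3a q r = ∸-from (pos-3a q r)

  pos-< : ∀ q {r} → r < a → pos q r < suc q * a
  pos-< q {r} r<a = subst (pos q r <_) (+-comm (q * a) a) (+-monoʳ-< (q * a) r<a)

  a≤2a+1 : a ≤ 2 * a + 1
  a≤2a+1 = ≤-trans (m≤m+n a (a + 0)) (m≤m+n (2 * a) 1)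

  2a+1≤3a : 2 * a + 1 ≤ 3 * a
  2a+1≤3a = subst (2 * a + 1 ≤_) (+-comm (2 * a) a) (+-monoʳ-≤ (2 * a) (s≤s z≤n))

  -- The options of n: the legal moves always form a prefix of a < 2a + 1 < 3a.
  options-none : ∀ {n} → n < a → reachable moves moves n ≡ []
  options-none {n} n<a =
    trans (reachable-illegal moves (2 * a + 1 ∷ 3 * a ∷ []) n n<a)
      (trans (reachable-illegal moves (3 * a ∷ []) n (≤-trans n<a a≤2a+1))
        (reachable-illegal moves [] n (≤-trans n<a (≤-trans a≤2a+1 2a+1≤3a))))

  options-one : ∀ {n} → a ≤ n → n < 2 * a + 1 →
    reachable moves moves n ≡ G (n ∸ a) ∷ []
  options-one {n} a≤n n<2a+1 =
    trans (reachable-legal moves (2 * a + 1 ∷ 3 * a ∷ []) n a≤n)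
      (cong (G (n ∸ a) ∷_) (trans (reachable-illegal moves (3 * a ∷ []) n n<2a+1)
        (reachable-illegal moves [] n (<-≤-trans n<2a+1 2a+1≤3a))))

  options-two : ∀ {n} → 2 * a + 1 ≤ n → n < 3 * a →
    reachable moves moves n ≡ G (n ∸ a) ∷ G (n ∸ (2 * a + 1)) ∷ []
  options-two {n} 2a+1≤n n<3a =
    trans (reachable-legal moves (2 * a + 1 ∷ 3 * a ∷ []) n a≤n)
      (cong (G (n ∸ a) ∷_) (trans (reachable-legal moves (3 * a ∷ []) n 2a+1≤n)
        (cong (G (n ∸ (2 * a + 1)) ∷_) (reachable-illegal moves [] n n<3a))))
    where
    a≤n : a ≤ n
    a≤n = ≤-trans a≤2a+1 2a+1≤n

  options-three : ∀ {n} → 3 * a ≤ n →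
    reachable moves moves n ≡ G (n ∸ a) ∷ G (n ∸ (2 * a + 1)) ∷ G (n ∸ 3 * a) ∷ []
  options-three {n} 3a≤n = reachable-all moves moves n
    ((s≤s z≤n , ≤-trans a≤2a+1 2a+1≤n) ∷ (s≤s z≤n , 2a+1≤n) ∷ (s≤s z≤n , 3a≤n) ∷ [])
    where
    2a+1≤n : 2 * a + 1 ≤ n
    2a+1≤n = ≤-trans 2a+1≤3a 3a≤n

  G-row₀ : ∀ {r} → r < a → G (pos 0 r) ≡ 0
  G-row₀ {r} r<a = trans (grundy-unfold moves r) (cong mex (options-none r<a))

  G-row₁ : ∀ {r} → r < a → G (pos 1 r) ≡ mex (G (pos 0 r) ∷ [])
  G-row₁ {r} r<a = begin
    G (pos 1 r)                           ≡⟨ grundy-unfold moves (pos 1 r) ⟩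
    mex (reachable moves moves (pos 1 r)) ≡⟨ cong mex (options-one (legal-a 0 r) row₁<2a+1) ⟩
    mex (G (pos 1 r ∸ a) ∷ [])            ≡⟨ cong (λ n → mex (G n ∷ [])) (minus-a 0 r) ⟩
    mex (G (pos 0 r) ∷ [])                ∎
    where
    open ≡-Reasoning
    row₁<2a+1 : pos 1 r < 2 * a + 1
    row₁<2a+1 = <-≤-trans (pos-< 1 r<a) (m≤m+n (2 * a) 1)

  G-row₂-zero : G (pos 2 0) ≡ mex (G (pos 1 0) ∷ [])
  G-row₂-zero = begin
    G (pos 2 0)                           ≡⟨ grundy-unfold moves (pos 2 0) ⟩
    mex (reachable moves moves (pos 2 0)) ≡⟨ cong mex (options-one (legal-a 1 0) 2a<2a+1) ⟩
    mex (G (pos 2 0 ∸ a) ∷ [])            ≡⟨ cong (λ n → mex (G n ∷ [])) (minus-a 1 0) ⟩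
    mex (G (pos 1 0) ∷ [])                ∎
    where
    open ≡-Reasoning
    2a<2a+1 : pos 2 0 < 2 * a + 1
    2a<2a+1 = ≤-reflexive (trans (cong suc (+-identityʳ (2 * a))) (+-comm 1 (2 * a)))

  G-row₂-suc : ∀ {s} → suc s < a → G (pos 2 (suc s)) ≡ mex (G (pos 1 (suc s)) ∷ G (pos 0 s) ∷ [])
  G-row₂-suc {s} s<a = begin
    G n                                         ≡⟨ grundy-unfold moves n ⟩
    mex (reachable moves moves n)               ≡⟨ cong mex (options-two (legal-2a+1 0 s) (pos-< 2 s<a)) ⟩
    mex (G (n ∸ a) ∷ G (n ∸ (2 * a + 1)) ∷ [])  ≡⟨ cong₂ (λ x y → mex (G x ∷ G y ∷ []))
                                                     (minus-a 1 (suc s)) (minus-2a+1 0 s) ⟩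
    mex (G (pos 1 (suc s)) ∷ G (pos 0 s) ∷ [])  ∎
    where
    open ≡-Reasoning
    n : ℕ
    n = pos 2 (suc s)

  G-row₃₊ : ∀ q r {x y} → pos (3 + q) r ∸ a ≡ x → pos (3 + q) r ∸ (2 * a + 1) ≡ y →
    G (pos (3 + q) r) ≡ mex (G x ∷ G y ∷ G (pos q r) ∷ [])
  G-row₃₊ q r {x} {y} minus-a≡x minus-2a+1≡y = begin
    G n
      ≡⟨ grundy-unfold moves n ⟩
    mex (reachable moves moves n)
      ≡⟨ cong mex (options-three (legal-3a q r)) ⟩
    mex (G (n ∸ a) ∷ G (n ∸ (2 * a + 1)) ∷ G (n ∸ 3 * a) ∷ [])
      ≡⟨ mex₃-cong (cong G minus-a≡x) (cong G minus-2a+1≡y) (cong G (minus-3a q r)) ⟩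
    mex (G x ∷ G y ∷ G (pos q r) ∷ []) ∎
    where
    open ≡-Reasoning
    n : ℕ
    n = pos (3 + q) r

  Describes : ℕ → (ℕ → ℕ) → Set
  Describes q f = ∀ r → r < a → G (pos q r) ≡ f r

  next-row : ∀ q {f₀ f₁ f₂ f₃ : ℕ → ℕ} →
    Describes q f₀ → Describes (1 + q) f₁ → Describes (2 + q) f₂ →
    f₃ 0 ≡ mex (f₂ 0 ∷ f₀ c ∷ f₀ 0 ∷ []) →
    (∀ s → f₃ (suc s) ≡ mex (f₂ (suc s) ∷ f₁ s ∷ f₀ (suc s) ∷ [])) →
    Describes (3 + q) f₃
  next-row q {f₀} {f₁} {f₂} {f₃} row₀ row₁ row₂ rule-zero rule-suc zero 0<a = begin
    G (pos (3 + q) 0)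
      ≡⟨ G-row₃₊ q 0 (minus-a (2 + q) 0) (minus-2a+1-wrap q) ⟩
    mex (G (pos (2 + q) 0) ∷ G (pos q c) ∷ G (pos q 0) ∷ [])
      ≡⟨ mex₃-cong (row₂ 0 0<a) (row₀ c ≤-refl) (row₀ 0 0<a) ⟩
    mex (f₂ 0 ∷ f₀ c ∷ f₀ 0 ∷ [])
      ≡⟨ sym rule-zero ⟩
    f₃ 0 ∎
    where open ≡-Reasoning
  next-row q {f₀} {f₁} {f₂} {f₃} row₀ row₁ row₂ rule-zero rule-suc (suc s) s<a = begin
    G (pos (3 + q) (suc s))
      ≡⟨ G-row₃₊ q (suc s) (minus-a (2 + q) (suc s)) (minus-2a+1 (1 + q) s) ⟩
    mex (G (pos (2 + q) (suc s)) ∷ G (pos (1 + q) s) ∷ G (pos q (suc s)) ∷ [])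
      ≡⟨ mex₃-cong (row₂ (suc s) s<a) (row₁ s (<-trans (n<1+n s) s<a)) (row₀ (suc s) s<a) ⟩
    mex (f₂ (suc s) ∷ f₁ s ∷ f₀ (suc s) ∷ [])
      ≡⟨ sym (rule-suc s) ⟩
    f₃ (suc s) ∎
    where open ≡-Reasoning

  Row₀ Row₁ Row₂ Row₃ : ℕ → Set
  Row₀ j = Describes (j * 4) (λ r → shape₀ (r ⊖ j * 2))
  Row₁ j = Describes (1 + j * 4) (λ r → shape₁ (r ⊖ j * 2))
  Row₂ j = Describes (2 + j * 4) (λ r → shape₂ (r ⊖ j * 2))
  Row₃ j = Describes (3 + j * 4) (λ r → shape₃ (r ⊖ j * 2))

  row₀-base : Row₀ 0
  row₀-base r r<a = G-row₀ r<a

  row₁-base : Row₁ 0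
  row₁-base r r<a = trans (G-row₁ r<a) (cong (λ x → mex (x ∷ [])) (G-row₀ r<a))

  row₂-base : Row₂ 0
  row₂-base zero 0<a = trans G-row₂-zero (cong (λ x → mex (x ∷ [])) (row₁-base 0 0<a))
  row₂-base (suc s) s<a = trans (G-row₂-suc s<a)
    (cong₂ (λ x y → mex (x ∷ y ∷ [])) (row₁-base (suc s) s<a) (G-row₀ (<-trans (n<1+n s) s<a)))

  -- Every further row follows from the three below it by the matching board rule;
  -- the block offset 2j and the last column c = 2b are even.
  module _ (j : ℕ) where
    open ColumnZero {c} {j * 2} (par-double j)
      (trans (parℤ-⊖ c (j * 2)) (trans (par-double+ b (j * 2)) (par-double j)))

    row₃-step : Row₀ j → Row₁ j → Row₂ j → Row₃ j
    row₃-step row₀ row₁ row₂ =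
      next-row (j * 4) row₀ row₁ row₂ board-rule₃-zero (board-rule₃ (j * 2))

    row₀-step : Row₁ j → Row₂ j → Row₃ j → Row₀ (suc j)
    row₀-step row₁ row₂ row₃ =
      next-row (1 + j * 4) row₁ row₂ row₃ board-rule₀-zero (board-rule₀ (j * 2))

    row₁-step : Row₂ j → Row₃ j → Row₀ (suc j) → Row₁ (suc j)
    row₁-step row₂ row₃ row₀′ =
      next-row (2 + j * 4) row₂ row₃ row₀′ board-rule₁-zero (board-rule₁ (j * 2))

    row₂-step : Row₃ j → Row₀ (suc j) → Row₁ (suc j) → Row₂ (suc j)
    row₂-step row₃ row₀′ row₁′ =
      next-row (3 + j * 4) row₃ row₀′ row₁′ board-rule₂-zero (board-rule₂ (j * 2))

  Block : ℕ → Set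
  Block j = Row₀ j × Row₁ j × Row₂ j

  next-block : ∀ j → Block j → Block (suc j)
  next-block j (row₀ , row₁ , row₂) = row₀′ , row₁′ , row₂-step j row₃ row₀′ row₁′
    where
    row₃ : Row₃ j
    row₃ = row₃-step j row₀ row₁ row₂
    row₀′ : Row₀ (suc j)
    row₀′ = row₀-step j row₁ row₂ row₃
    row₁′ : Row₁ (suc j)
    row₁′ = row₁-step j row₂ row₃ row₀′

  blocks : ∀ j → Block j
  blocks zero = row₀-base , row₁-base , row₂-base
  blocks (suc j) = next-block j (blocks j)

  -- a is odd, so a position has the parity of its row plus its column.
  par-pos : ∀ q r → par (pos q r) ≡ par (q + r)
  par-pos zero r = refl
  par-pos (suc q) r = par-suc-cong {c + q * a + r} {q + r} (begin
    par (c + q * a + r)   ≡⟨ cong par (+-assoc c (q * a) r) ⟩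
    par (c + pos q r)     ≡⟨ par-double+ b (pos q r) ⟩
    par (pos q r)         ≡⟨ par-pos q r ⟩
    par (q + r)           ∎)
    where open ≡-Reasoning

  Alternates : ℕ → Set
  Alternates q = Describes q (λ r → par (pos q r))

  alternates : ∀ q {f} → Describes q f → (∀ r → r < a → f r ≡ par (q + r)) → Alternates q
  alternates q row f-par r r<a = trans (row r r<a) (trans (f-par r r<a) (sym (par-pos q r)))

  -- In block b + 1 every column r < a = 2b + 1 has offset r − 2b − 2 ≤ −2, left of
  -- all defects, so its first three rows alternate.
  q₀ : ℕ
  q₀ = suc b * 4

  deep-offset : ∀ {r} → r < a → Σ ℕ λ k → (r ⊖ suc b * 2 ≡ -[1+ suc k ]) × par k ≡ par (q₀ + r)
  deep-offset {r} r<a with offset-deep r (suc b * 2) (s≤s r<a)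
  ... | k , offset≡ = k , offset≡ , (begin
    parℤ -[1+ suc k ]       ≡⟨ cong parℤ (sym offset≡) ⟩
    parℤ (r ⊖ suc b * 2)    ≡⟨ parℤ-⊖ r (suc b * 2) ⟩
    par (r + suc b * 2)     ≡⟨ cong par (+-comm r (suc b * 2)) ⟩
    par (suc b * 2 + r)     ≡⟨ par-double+ (suc b) r ⟩
    par r                   ≡⟨ sym (par-quadruple+ (suc b) r) ⟩
    par (q₀ + r)            ∎)
    where open ≡-Reasoning

  last-block : Alternates q₀ × Alternates (1 + q₀) × Alternates (2 + q₀)
  last-block = alternates q₀ row₀ shape₀-par , alternates (1 + q₀) row₁ shape₁-par ,
               alternates (2 + q₀) row₂ shape₂-par
    where
    row₀ : Row₀ (suc b)
    row₀ = proj₁ (blocks (suc b))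
    row₁ : Row₁ (suc b)
    row₁ = proj₁ (proj₂ (blocks (suc b)))
    row₂ : Row₂ (suc b)
    row₂ = proj₂ (proj₂ (blocks (suc b)))
    shape₀-par : ∀ r → r < a → shape₀ (r ⊖ suc b * 2) ≡ par (q₀ + r)
    shape₀-par r r<a with deep-offset r<a
    ... | k , offset≡ , k-par = trans (cong shape₀ offset≡) k-par
    shape₁-par : ∀ r → r < a → shape₁ (r ⊖ suc b * 2) ≡ par (suc (q₀ + r))
    shape₁-par r r<a with deep-offset r<a
    ... | k , offset≡ , k-par = trans (cong shape₁ offset≡) (par-suc-cong {k} {q₀ + r} k-par)
    shape₂-par : ∀ r → r < a → shape₂ (r ⊖ suc b * 2) ≡ par (suc (suc (q₀ + r)))
    shape₂-par r r<a with deep-offset r<a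
    ... | k , offset≡ , k-par = trans (cong shape₂ offset≡) k-par

  rows-cover : ∀ q k → (∀ i → i < k → Alternates (i + q)) →
    ∀ t → t < k * a → G (q * a + t) ≡ par (q * a + t)
  rows-cover q zero _ t ()
  rows-cover q (suc k) alt t t<ka with t <? a
  ... | yes t<a = alt 0 (s≤s z≤n) t t<a
  ... | no t≮a = subst (λ n → G n ≡ par n) shift (rows-cover (suc q) k alt′ (t ∸ a) t∸a<ka)
    where
    a≤t : a ≤ t
    a≤t = ≮⇒≥ t≮a
    shift : suc q * a + (t ∸ a) ≡ q * a + t
    shift = begin
      (a + q * a) + (t ∸ a)  ≡⟨ cong (_+ (t ∸ a)) (+-comm a (q * a)) ⟩
      (q * a + a) + (t ∸ a)  ≡⟨ +-assoc (q * a) a (t ∸ a) ⟩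
      q * a + (a + (t ∸ a))  ≡⟨ cong (λ x → q * a + x) (m+[n∸m]≡n a≤t) ⟩
      q * a + t              ∎
      where open ≡-Reasoning
    alt′ : ∀ i → i < k → Alternates (i + suc q)
    alt′ i i<k = subst Alternates (sym (+-suc i q)) (alt (suc i) (s≤s i<k))
    t∸a<ka : t ∸ a < k * a
    t∸a<ka = subst (t ∸ a <_) (m+n∸m≡n a (k * a)) (∸-monoˡ-< t<ka a≤t)

  window : ∀ t → t < 3 * a → G (q₀ * a + t) ≡ par (q₀ * a + t)
  window = rows-cover q₀ 3 rows
    where
    rows : ∀ i → i < 3 → Alternates (i + q₀)
    rows 0 _ = proj₁ last-block
    rows 1 _ = proj₁ (proj₂ last-block)
    rows 2 _ = proj₂ (proj₂ last-block)
    rows (suc (suc (suc _))) (s≤s (s≤s (s≤s ())))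

  odd-moves : All (λ x → par x ≡ 1) moves
  odd-moves = a-odd ∷ trans (cong par 2a+1≡a*2+1) (par-double+ a 1) ∷
              trans (cong par 3a≡a*2+a) (trans (par-double+ a a) a-odd) ∷ []
    where
    a-odd : par a ≡ 1
    a-odd = par-even-suc {c} (par-double b)
    2a+1≡a*2+1 : 2 * a + 1 ≡ a * 2 + 1
    2a+1≡a*2+1 = cong (_+ 1) (*-comm 2 a)
    3a≡a*2+a : 3 * a ≡ a * 2 + a
    3a≡a*2+a = shuffle a
      where
      shuffle : ∀ y → 3 * y ≡ y * 2 + y
      shuffle = solve-∀

  bounded-moves : All (_≤ 3 * a) moves
  bounded-moves = ≤-trans a≤2a+1 2a+1≤3a ∷ 2a+1≤3a ∷ ≤-refl ∷ []

  alternates-forever : ∀ t → G (q₀ * a + t) ≡ par t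
  alternates-forever t = begin
    G (q₀ * a + t)    ≡⟨ parity-propagates (q₀ * a) (3 * a) odd-moves bounded-moves window t ⟩
    par (pos q₀ t)    ≡⟨ par-pos q₀ t ⟩
    par (q₀ + t)      ≡⟨ par-quadruple+ (suc b) t ⟩
    par t             ∎
    where open ≡-Reasoning

  ultimately-bipartite : UltimatelyBipartite moves
  ultimately-bipartite = q₀ * a , λ k →
    trans (alternates-forever (2 * k)) (even k) ,
    trans (cong G (+-assoc (q₀ * a) (2 * k) 1)) (trans (alternates-forever (2 * k + 1)) (odd k))
    where
    even : ∀ k → par (2 * k) ≡ 0
    even k = trans (cong par (*-comm 2 k)) (par-double k)
    odd : ∀ k → par (2 * k + 1) ≡ 1
    odd k = trans (cong par (+-comm (2 * k) 1)) (par-even-suc {2 * k} (even k))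

theorem7p1 : (b : ℕ) → 2 ≤ b →
    UltimatelyBipartite ((2 * b + 1) ∷ (2 * (2 * b + 1) + 1) ∷ (3 * (2 * b + 1)) ∷ [])
theorem7p1 b _ = subst (λ a → UltimatelyBipartite (a ∷ 2 * a + 1 ∷ 3 * a ∷ [])) a≡2b+1
  (ThreeMoveGame.ultimately-bipartite b)
  where
  a≡2b+1 : suc (b * 2) ≡ 2 * b + 1
  a≡2b+1 = trans (cong suc (*-comm b 2)) (+-comm 1 (2 * b))
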